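{- In the setting described in the context, the minimum number of bins of a feasible BPUP' solution for the rounded instance $I'$ is at most $(1+\varepsilon)\mathrm{OPT}+1$, where $\mathrm{OPT}$ is the minimum number of bins of a feasible BPUP solution for the original instance $I$.
   Context: BPUP: an instance $I$ has items $\mathcal{I}$ with sizes $s_i\in[0,1]$, a rational $U\in(0,1]$, a positive integer $k$, bins of capacity $1$; the load of a nonempty set $p$ in a bin is $\sum_{i\in p}s_i+\lfloor(|p|-1)/k\rfloor U$; feasible solutions partition the items into bins of load at most $1$. Let $\varepsilon>0$ with $1/\varepsilon\in\mathbb{Z}$ and assume $\lfloor k/U\rfloor+k>1/\varepsilon^2$. Items of size $<\varepsilon$ are small, the others large; $\mathcal{S},\mathcal{L}$ the small and large items. Sort $\mathcal{L}$ in non-increasing size order and split it into $1/\varepsilon^3$ classes $\mathcal{L}_1,\dots,\mathcal{L}_{1/\varepsilon^3}$ of consecutive items with $\lceil\varepsilon^3|\mathcal{L}|\rceil=|\mathcal{L}_1|\ge\dots\ge|\mathcal{L}_{1/\varepsilon^3}|=\lfloor\varepsilon^3|\mathcal{L}|\rfloor$. The rounded instance $I'$ consists of $\mathcal{S}$ (original sizes) and $\mathcal{L}\setminus\mathcal{L}_1$, each item of $\mathcal{L}_i$ ($i\ge2$) rounded up to the largest size in $\mathcal{L}_i$. Problem BPUP': for a bin $p$, sort its items in non-increasing size, ties by increasing index; early items $E_p$ = first $k/\varepsilon$ items, late items $\Lambda_p$ = the rest; late items have modified size $s_i+U/k$. The load of $p$ is $\sum_{i\in E_p}s_i+\sum_{i\in\Lambda_p}(s_i+U/k)+\frac{|E_p|}{k}U$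 if $\Lambda_p\ne\emptyset$, and $\sum_{i\in E_p}s_i+\lfloor(|E_p|-1)/k\rfloor U$ otherwise; a feasible solution partitions the items into bins of load at most $1$.
   Formalization: The item sizes $s_i$ of the instance $I$ are rational numbers in [0,1]. -}

module Defs where

open import Data.Nat as ℕ using (ℕ; zero; suc; NonZero)
import Data.Nat.Properties as ℕP
open import Data.Integer as ℤ using (ℤ; +_)
open import Data.Rational as ℚ using (ℚ; 0ℚ; 1ℚ; _+_; _*_; _/_; _≤_; _<_; floor)
import Data.Rational.Properties as ℚP
open import Data.List as L using (List; []; _∷_; _++_; length; map; filter; take; drop; reverse; concat; replicate; allFin; upTo)
open import Data.Fin as Fin using (Fin)
open import Data.Bool using (if_then_else_)
open import Data.Product using (Σ; _×_)
open import Relation.Nullary.Decidable using (¬?)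
import Data.List.Sort as Sorting

sumℚ : List ℚ → ℚ
sumℚ = L.foldr _+_ 0ℚ

nℚ : ℕ → ℚ
nℚ n = + n / 1

-- ε = 1/m  (m = 1/ε is a positive integer)
eps : (m : ℕ) .{{_ : NonZero m}} → ℚ
eps m = + 1 / m

divByU : ℕ → (U : ℚ) → 0ℚ < U → ℚ
divByU k U 0<U = ℚ._÷_ (nℚ k) U {{ℚ.>-nonZero 0<U}}

-- sorting in non-increasing order (ties are irrelevant: only sizes matter)
open Sorting ℚP.≤-decTotalOrder using (sort)

sortDesc : List ℚ → List ℚ
sortDesc xs = reverse (sort xs)

-- Instances are lists of item sizes; items are the positions
-- Fin (length xs).  A solution with b bins assigns every item a bin.

binContents : (xs : List ℚ) {b : ℕ} → (Fin (length xs) → Fin b) → Fin b → List ℚ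
binContents xs f j = map (L.lookup xs) (filter (λ i → f i Fin.≟ j) (allFin (length xs)))

loadBPUP : (U : ℚ) (k : ℕ) .{{_ : NonZero k}} → List ℚ → ℚ
loadBPUP U k [] = 0ℚ
loadBPUP U k ys@(_ ∷ _) = sumℚ ys + nℚ ((length ys ℕ.∸ 1) ℕ./ k) * U

FeasibleBPUP : (U : ℚ) (k : ℕ) .{{_ : NonZero k}} → List ℚ → ℕ → Set
FeasibleBPUP U k xs b =
  Σ (Fin (length xs) → Fin b) λ f → ∀ j → loadBPUP U k (binContents xs f j) ≤ 1ℚ

IsOptBPUP : (U : ℚ) (k : ℕ) .{{_ : NonZero k}} → List ℚ → ℕ → Set
IsOptBPUP U k xs b = FeasibleBPUP U k xs b × (∀ b′ → FeasibleBPUP U k xs b′ → b ℕ.≤ b′)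

-- BPUP' load given early items E and late items Λ
loadEL : (U : ℚ) (k : ℕ) .{{_ : NonZero k}} → List ℚ → List ℚ → ℚ
loadEL U k E [] = loadBPUP U k E
loadEL U k E Λ@(_ ∷ _) =
  sumℚ E + sumℚ (map (λ x → x + U * (+ 1 / k)) Λ) + nℚ (length E) * (+ 1 / k) * U

-- BPUP' load: early items = first k/ε = k·m items in non-increasing order
loadBPUP' : (U : ℚ) (k m : ℕ) .{{_ : NonZero k}} → List ℚ → ℚ
loadBPUP' U k m ys = loadEL U k (take (k ℕ.* m) (sortDesc ys)) (drop (k ℕ.* m) (sortDesc ys))

FeasibleBPUP' : (U : ℚ) (k m : ℕ) .{{_ : NonZero k}} → List ℚ → ℕ → Set
FeasibleBPUP' U k m xs b =
  Σ (Fin (length xs) → Fin b) λ f → ∀ j → loadBPUP' U k m (binContents xs f j) ≤ 1ℚ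

IsOptBPUP' : (U : ℚ) (k m : ℕ) .{{_ : NonZero k}} → List ℚ → ℕ → Set
IsOptBPUP' U k m xs b = FeasibleBPUP' U k m xs b × (∀ b′ → FeasibleBPUP' U k m xs b′ → b ℕ.≤ b′)

smallItems : (m : ℕ) .{{_ : NonZero m}} → List ℚ → List ℚ
smallItems m = filter (λ x → x ℚP.<? eps m)

largeItems : (m : ℕ) .{{_ : NonZero m}} → List ℚ → List ℚ
largeItems m = filter (λ x → ¬? (x ℚP.<? eps m))

-- sizes of the c classes for N items: ⌈N/c⌉ = |class 1| ≥ … ≥ |class c| = ⌊N/c⌋
classSizes : (N c : ℕ) .{{_ : NonZero c}} → List ℕ
classSizes N c = map (λ j → N ℕ./ c ℕ.+ (if j ℕ.<ᵇ N ℕ.% c then 1 else 0)) (upTo c)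

splitBy : List ℕ → List ℚ → List (List ℚ)
splitBy [] _ = []
splitBy (s ∷ ss) ys = take s ys ∷ splitBy ss (drop s ys)

-- round every item of a (non-increasing) class up to its largest size
roundClass : List ℚ → List ℚ
roundClass [] = []
roundClass (x ∷ xs) = replicate (suc (length xs)) x

-- the 1/ε³ = m³ classes L_1, …, L_{m³} of the large items
classes : (m : ℕ) .{{_ : NonZero m}} → List ℚ → List (List ℚ)
classes m xs =
  splitBy (classSizes (length (largeItems m xs)) (m ℕ.^ 3) {{ℕP.m^n≢0 m 3}})
          (sortDesc (largeItems m xs))

-- I' = small items ∪ rounded L_2, …, L_{m³}  (L_1 is discarded)
rounded : (m : ℕ) .{{_ : NonZero m}} → List ℚ → List ℚ
rounded m xs = smallItems m xs ++ concat (map roundClass (drop 1 (classes m xs)))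

-- Linear grouping: every rounded class of I′ is dominated item by item by the preceding class
-- of I, so an optimal BPUP packing of I induces a packing of I′ into OPT bins, none of which
-- gains total size or items.  A BPUP′ load never exceeds the amortised load, in which every
-- item pays U/k, and it equals the BPUP load for bins of at most k/ε items.  A fuller bin of
-- n items keeps all but its k smallest: charging U/k to each of the n − k kept items costs at
-- most ⌊(n−1)/k⌋U.  The k removed items weigh at most ε times the bin, and the bin pays at
-- least U/ε, so 1/ε removed blocks share one BPUP′ bin.  This uses OPT + ⌊ε OPT⌋ + 1 bins.

module Submission where

open import Defs
open import Data.Bool using (Bool; true; false; if_then_else_)
open import Data.Empty using (⊥-elim)
open import Data.Fin as Fin using (Fin; zero; suc)
import Data.Fin.Properties as FinP
open import Data.Integer as ℤ using (+_)
import Data.Integer.Properties as ℤP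
open import Data.List as L using (List; []; _∷_; _++_; length; map; filter; take; drop; reverse; concat; replicate; tabulate)
open import Data.List.Relation.Unary.All as All using (All; []; _∷_)
import Data.List.Relation.Unary.All.Properties as AllP
open import Data.List.Relation.Unary.AllPairs using (AllPairs; []; _∷_)
import Data.List.Relation.Unary.AllPairs.Properties as AllPairsP
open import Data.List.Relation.Unary.Linked using (Linked; _∷_)
import Data.List.Relation.Unary.Linked.Properties as LinkedP
open import Data.List.Relation.Binary.Permutation.Propositional as ↭
  using (_↭_; ↭-refl; ↭-reflexive; ↭-sym; ↭-trans; ↭⇒↭ₛ; module PermutationReasoning)
import Data.List.Relation.Binary.Permutation.Propositional.Properties as PermP
open import Data.List.Membership.Propositional.Properties using (∈-lookup)
import Data.List.Properties as LP
open import Data.Nat as ℕ using (ℕ; zero; suc; NonZero)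
import Data.Nat.Properties as ℕP
import Data.Nat.DivMod as ℕD
import Data.Nat.Coprimality as Coprime
open import Data.Product using (Σ; _×_; _,_; proj₁; proj₂)
open import Data.Sum using (_⊎_; inj₁; inj₂)
open import Data.Rational as ℚ using (ℚ; 0ℚ; 1ℚ; _+_; _*_; _≤_; _<_; floor)
import Data.Rational.Properties as ℚP
open import Data.Rational.Solver using (module +-*-Solver)
open import Function using (_∘_; id)
import Data.Vec.Functional as Vector
open import Relation.Binary.PropositionalEquality
open import Relation.Nullary using (Dec; yes; no; does)
open import Relation.Nullary.Decidable using (¬?)

open +-*-Solver

nℚ≡mkℚ : ∀ n → nℚ n ≡ ℚ.mkℚ (+ n) 0 (Coprime.sym (Coprime.1-coprimeTo n))
nℚ≡mkℚ n = ℚP.normalize-coprime (Coprime.sym (Coprime.1-coprimeTo n))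

nℚ-+ : ∀ a b → nℚ (a ℕ.+ b) ≡ nℚ a + nℚ b
nℚ-+ a b = begin
  nℚ (a ℕ.+ b)                        ≡⟨ cong (ℚ._/ 1) (cong₂ ℤ._+_ (sym (ℤP.*-identityʳ (+ a))) (sym (ℤP.*-identityʳ (+ b)))) ⟩
  (+ a ℤ.* + 1 ℤ.+ + b ℤ.* + 1) ℚ./ 1 ≡⟨ sym (cong₂ _+_ (nℚ≡mkℚ a) (nℚ≡mkℚ b)) ⟩
  nℚ a + nℚ b                         ∎
  where open ≡-Reasoning

nℚ-* : ∀ a b → nℚ (a ℕ.* b) ≡ nℚ a * nℚ b
nℚ-* a b = trans (cong (ℚ._/ 1) (ℤP.pos-* a b)) (sym (cong₂ _*_ (nℚ≡mkℚ a) (nℚ≡mkℚ b)))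

nℚ-suc : ∀ n → nℚ (suc n) ≡ 1ℚ + nℚ n
nℚ-suc n = nℚ-+ 1 n

nℚ-mono-≤ : ∀ {a b} → a ℕ.≤ b → nℚ a ≤ nℚ b
nℚ-mono-≤ {a} {b} a≤b rewrite nℚ≡mkℚ a | nℚ≡mkℚ b =
  ℚ.*≤* (ℤP.*-monoʳ-≤-nonNeg (+ 1) (ℤ.+≤+ a≤b))

nℚ-nonNeg : ∀ n → 0ℚ ≤ nℚ n
nℚ-nonNeg n = nℚ-mono-≤ {0} {n} ℕ.z≤n

nℚ-pos : ∀ n .{{_ : NonZero n}} → 0ℚ < nℚ n
nℚ-pos (suc n) rewrite nℚ≡mkℚ (suc n) = ℚ.*<* (ℤ.+<+ (ℕ.s≤s ℕ.z≤n))

1/ℕ : (n : ℕ) .{{_ : NonZero n}} → ℚ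
1/ℕ n = + 1 ℚ./ n

1/ℕ-nonNeg : ∀ n .{{_ : NonZero n}} → 0ℚ ≤ 1/ℕ n
1/ℕ-nonNeg n = ℚP.nonNegative⁻¹ _ {{ℚP.normalize-nonNeg 1 n}}

nℚ*1/ℕ≡1 : ∀ n .{{_ : NonZero n}} → nℚ n * 1/ℕ n ≡ 1ℚ
nℚ*1/ℕ≡1 (suc n)
  rewrite nℚ≡mkℚ (suc n) | ℚP.normalize-coprime {1} {n} (Coprime.1-coprimeTo (suc n)) =
  ℚP.*-inverseʳ (ℚ.mkℚ (+ suc n) 0 (Coprime.sym (Coprime.1-coprimeTo (suc n))))

nℚ[a*n]*1/ℕn≡nℚa : ∀ a n .{{_ : NonZero n}} → nℚ (a ℕ.* n) * 1/ℕ n ≡ nℚ a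
nℚ[a*n]*1/ℕn≡nℚa a n = begin
  nℚ (a ℕ.* n) * 1/ℕ n   ≡⟨ cong (_* 1/ℕ n) (nℚ-* a n) ⟩
  nℚ a * nℚ n * 1/ℕ n    ≡⟨ ℚP.*-assoc (nℚ a) (nℚ n) (1/ℕ n) ⟩
  nℚ a * (nℚ n * 1/ℕ n)  ≡⟨ cong (nℚ a *_) (nℚ*1/ℕ≡1 n) ⟩
  nℚ a * 1ℚ              ≡⟨ ℚP.*-identityʳ (nℚ a) ⟩
  nℚ a                   ∎
  where open ≡-Reasoning

nℚ-≤-*1/ℕ : ∀ {a b} n .{{_ : NonZero n}} → a ℕ.* n ℕ.≤ b → nℚ a ≤ nℚ b * 1/ℕ n
nℚ-≤-*1/ℕ {a} {b} n a*n≤b = begin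
  nℚ a                  ≡⟨ nℚ[a*n]*1/ℕn≡nℚa a n ⟨
  nℚ (a ℕ.* n) * 1/ℕ n  ≤⟨ ℚP.*-monoʳ-≤-nonNeg (1/ℕ n) {{ℚ.nonNegative (1/ℕ-nonNeg n)}} (nℚ-mono-≤ a*n≤b) ⟩
  nℚ b * 1/ℕ n          ∎
  where open ℚP.≤-Reasoning

*1/ℕ-≤-nℚ : ∀ {a b} n .{{_ : NonZero n}} → b ℕ.≤ a ℕ.* n → nℚ b * 1/ℕ n ≤ nℚ a
*1/ℕ-≤-nℚ {a} {b} n b≤a*n = begin
  nℚ b * 1/ℕ n          ≤⟨ ℚP.*-monoʳ-≤-nonNeg (1/ℕ n) {{ℚ.nonNegative (1/ℕ-nonNeg n)}} (nℚ-mono-≤ b≤a*n) ⟩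
  nℚ (a ℕ.* n) * 1/ℕ n  ≡⟨ nℚ[a*n]*1/ℕn≡nℚa a n ⟩
  nℚ a                  ∎
  where open ℚP.≤-Reasoning

*-monoˡ-≤-0≤ : ∀ {r p q} → 0ℚ ≤ r → p ≤ q → r * p ≤ r * q
*-monoˡ-≤-0≤ {r} 0≤r = ℚP.*-monoˡ-≤-nonNeg r {{ℚ.nonNegative 0≤r}}

*-monoʳ-≤-0≤ : ∀ {r p q} → 0ℚ ≤ r → p ≤ q → p * r ≤ q * r
*-monoʳ-≤-0≤ {r} 0≤r = ℚP.*-monoʳ-≤-nonNeg r {{ℚ.nonNegative 0≤r}}

*-cancelˡ-≤-0< : ∀ {r p q} → 0ℚ < r → r * p ≤ r * q → p ≤ q
*-cancelˡ-≤-0< {r} 0<r = ℚP.*-cancelˡ-≤-pos r {{ℚ.positive 0<r}}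

*-nonNeg : ∀ {p q} → 0ℚ ≤ p → 0ℚ ≤ q → 0ℚ ≤ p * q
*-nonNeg {p} {q} 0≤p 0≤q =
  ℚP.nonNegative⁻¹ _ {{ℚP.nonNeg*nonNeg⇒nonNeg p {{ℚ.nonNegative 0≤p}} q {{ℚ.nonNegative 0≤q}}}}

≤-+-0≤ : ∀ {p} q → 0ℚ ≤ q → p ≤ p + q
≤-+-0≤ {p} q 0≤q = ℚP.≤-trans (ℚP.≤-reflexive (sym (ℚP.+-identityʳ p))) (ℚP.+-monoʳ-≤ p 0≤q)

NonNeg : ℚ → Set
NonNeg x = 0ℚ ≤ x

sumℚ-++ : ∀ xs ys → sumℚ (xs ++ ys) ≡ sumℚ xs + sumℚ ys
sumℚ-++ [] ys = sym (ℚP.+-identityˡ _)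
sumℚ-++ (x ∷ xs) ys = trans (cong (λ s → x + s) (sumℚ-++ xs ys)) (sym (ℚP.+-assoc x _ _))

sumℚ-↭ : ∀ {xs ys} → xs ↭ ys → sumℚ xs ≡ sumℚ ys
sumℚ-↭ p = foldr-commMonoid ℚP.+-0-isCommutativeMonoid (↭⇒↭ₛ p)
  where open import Data.List.Relation.Binary.Permutation.Setoid.Properties (setoid ℚ) using (foldr-commMonoid)

sumℚ-nonNeg : ∀ {xs} → All NonNeg xs → 0ℚ ≤ sumℚ xs
sumℚ-nonNeg [] = ℚP.≤-refl
sumℚ-nonNeg (p ∷ ps) = ℚP.+-mono-≤ p (sumℚ-nonNeg ps)

sumℚ-map-+ : ∀ c xs → sumℚ (map (_+ c) xs) ≡ sumℚ xs + nℚ (length xs) * c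
sumℚ-map-+ c [] = sym (trans (ℚP.+-identityˡ _) (ℚP.*-zeroˡ c))
sumℚ-map-+ c (x ∷ xs) rewrite sumℚ-map-+ c xs | nℚ-suc (length xs) =
  solve 4 (λ x c s n → (x :+ c) :+ (s :+ n :* c) := (x :+ s) :+ (con 1ℚ :+ n) :* c)
        refl x c (sumℚ xs) (nℚ (length xs))

sumℚ-≤-length* : ∀ a xs → All (_≤ a) xs → sumℚ xs ≤ nℚ (length xs) * a
sumℚ-≤-length* a [] [] = ℚP.≤-reflexive (sym (ℚP.*-zeroˡ a))
sumℚ-≤-length* a (x ∷ xs) (x≤a ∷ xs≤a) = begin
  x + sumℚ xs                ≤⟨ ℚP.+-mono-≤ x≤a (sumℚ-≤-length* a xs xs≤a) ⟩
  a + nℚ (length xs) * a     ≡⟨ solve 2 (λ a n → a :+ n :* a := (con 1ℚ :+ n) :* a) refl a (nℚ (length xs)) ⟩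
  (1ℚ + nℚ (length xs)) * a  ≡⟨ cong (_* a) (nℚ-suc (length xs)) ⟨
  nℚ (length (x ∷ xs)) * a   ∎
  where open ℚP.≤-Reasoning

length*sumℚ-≤ : ∀ as bs → All (λ a → All (_≤ a) bs) as →
                nℚ (length as) * sumℚ bs ≤ nℚ (length bs) * sumℚ as
length*sumℚ-≤ [] bs [] = ℚP.≤-reflexive (trans (ℚP.*-zeroˡ (sumℚ bs)) (sym (ℚP.*-zeroʳ (nℚ (length bs)))))
length*sumℚ-≤ (a ∷ as) bs (bs≤a ∷ rest) = begin
  nℚ (suc (length as)) * sumℚ bs                 ≡⟨ cong (_* sumℚ bs) (nℚ-suc (length as)) ⟩
  (1ℚ + nℚ (length as)) * sumℚ bs                ≡⟨ solve 2 (λ n s → (con 1ℚ :+ n) :* s := s :+ n :* s) refl (nℚ (length as)) (sumℚ bs) ⟩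
  sumℚ bs + nℚ (length as) * sumℚ bs             ≤⟨ ℚP.+-mono-≤ (sumℚ-≤-length* a bs bs≤a) (length*sumℚ-≤ as bs rest) ⟩
  nℚ (length bs) * a + nℚ (length bs) * sumℚ as  ≡⟨ ℚP.*-distribˡ-+ (nℚ (length bs)) a (sumℚ as) ⟨
  nℚ (length bs) * (a + sumℚ as)                 ∎
  where open ℚP.≤-Reasoning

m+n≤1+o⇒m≤o/n*n : ∀ {m n o} .{{_ : NonZero n}} → m ℕ.+ n ℕ.≤ suc o → m ℕ.≤ (o ℕ./ n) ℕ.* n
m+n≤1+o⇒m≤o/n*n {m} {n} {o} m+n≤1+o = ℕP.+-cancelʳ-≤ n m _ (begin
  m ℕ.+ n                            ≤⟨ m+n≤1+o ⟩
  suc o                              ≡⟨ cong suc (ℕD.m≡m%n+[m/n]*n o n) ⟩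
  suc (o ℕ.% n ℕ.+ (o ℕ./ n) ℕ.* n)  ≤⟨ ℕP.+-monoˡ-≤ _ (ℕD.m%n<n o n) ⟩
  n ℕ.+ (o ℕ./ n) ℕ.* n              ≡⟨ ℕP.+-comm n _ ⟩
  (o ℕ./ n) ℕ.* n ℕ.+ n              ∎)
  where open ℕP.≤-Reasoning

Desc : List ℚ → Set
Desc = AllPairs ℚ._≥_

AllPairs-++⁻ : ∀ {A : Set} {R : A → A → Set} xs {ys} → AllPairs R (xs ++ ys) → All (λ x → All (R x) ys) xs
AllPairs-++⁻ [] _ = []
AllPairs-++⁻ (x ∷ xs) (Rx ∷ Rxs) = AllP.++⁻ʳ xs Rx ∷ AllPairs-++⁻ xs Rxs

AllPairs-reverse⁺ : ∀ {A : Set} {R : A → A → Set} {xs} → AllPairs R xs → AllPairs (λ a b → R b a) (reverse xs)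
AllPairs-reverse⁺ [] = []
AllPairs-reverse⁺ {xs = x ∷ xs} (Rx ∷ Rxs) rewrite LP.unfold-reverse x xs =
  AllPairsP.++⁺ (AllPairs-reverse⁺ Rxs) ([] ∷ [])
    (All.map (_∷ []) (PermP.All-resp-↭ (↭-sym (PermP.↭-reverse xs)) Rx))

sortDesc-↭ : ∀ xs → sortDesc xs ↭ xs
sortDesc-↭ xs = ↭-trans (PermP.↭-reverse _) (sort-↭ xs)
  where open import Data.List.Sort ℚP.≤-decTotalOrder using (sort-↭)

sortDesc-length : ∀ xs → length (sortDesc xs) ≡ length xs
sortDesc-length xs = PermP.↭-length (sortDesc-↭ xs)

sortDesc-desc : ∀ xs → Desc (sortDesc xs)
sortDesc-desc xs = AllPairs-reverse⁺ (Sorted⇒AllPairs (DecTotalOrder.totalOrder ℚP.≤-decTotalOrder) (sort-↗ xs))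
  where
  open import Data.List.Sort ℚP.≤-decTotalOrder using (sort-↗)
  open import Data.List.Relation.Unary.Sorted.TotalOrder.Properties using (Sorted⇒AllPairs)
  open import Relation.Binary.Bundles using (DecTotalOrder)

record _⊑_ (A B : List ℚ) : Set where
  field
    sum-≤    : sumℚ A ≤ sumℚ B
    length-≤ : length A ℕ.≤ length B
open _⊑_

⊑-refl : ∀ {A} → A ⊑ A
⊑-refl = record { sum-≤ = ℚP.≤-refl ; length-≤ = ℕP.≤-refl }

⊑-trans : ∀ {A B C} → A ⊑ B → B ⊑ C → A ⊑ C
⊑-trans A⊑B B⊑C = record { sum-≤ = ℚP.≤-trans (sum-≤ A⊑B) (sum-≤ B⊑C)
                         ; length-≤ = ℕP.≤-trans (length-≤ A⊑B) (length-≤ B⊑C) }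

↭⇒⊑ : ∀ {A B} → A ↭ B → A ⊑ B
↭⇒⊑ p = record { sum-≤ = ℚP.≤-reflexive (sumℚ-↭ p) ; length-≤ = ℕP.≤-reflexive (PermP.↭-length p) }

consIf : ∀ {A : Set} → Bool → A → List A → List A
consIf c x xs = if c then x ∷ xs else xs

⊑-consIf : ∀ c {x y A B} → y ≤ x → A ⊑ B → consIf c y A ⊑ consIf c x B
⊑-consIf false y≤x A⊑B = A⊑B
⊑-consIf true  y≤x A⊑B = record { sum-≤ = ℚP.+-mono-≤ y≤x (sum-≤ A⊑B) ; length-≤ = ℕ.s≤s (length-≤ A⊑B) }

⊑-consIfʳ : ∀ c {x A B} → 0ℚ ≤ x → A ⊑ B → A ⊑ consIf c x B
⊑-consIfʳ false 0≤x A⊑B = A⊑B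
⊑-consIfʳ true {x} {B = B} 0≤x A⊑B = record
  { sum-≤    = ℚP.≤-trans (sum-≤ A⊑B) (ℚP.≤-trans (ℚP.≤-reflexive (sym (ℚP.+-identityˡ (sumℚ B)))) (ℚP.+-monoˡ-≤ (sumℚ B) 0≤x))
  ; length-≤ = ℕP.m≤n⇒m≤1+n (length-≤ A⊑B) }

⊑-consIf-swap : ∀ c d {x y A B} → A ⊑ B → consIf c x (consIf d y A) ⊑ consIf d y (consIf c x B)
⊑-consIf-swap false d A⊑B = ⊑-consIf d ℚP.≤-refl A⊑B
⊑-consIf-swap true false A⊑B = ⊑-consIf true ℚP.≤-refl A⊑B
⊑-consIf-swap true true {x} {y} {A} {B} A⊑B = record
  { sum-≤    = ℚP.≤-trans (ℚP.≤-reflexive (solve 3 (λ x y s → x :+ (y :+ s) := y :+ (x :+ s)) refl x y (sumℚ A)))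
                          (ℚP.+-monoʳ-≤ y (ℚP.+-monoʳ-≤ x (sum-≤ A⊑B)))
  ; length-≤ = ℕ.s≤s (ℕ.s≤s (length-≤ A⊑B)) }

amortisedLoad : (U : ℚ) (k : ℕ) .{{_ : NonZero k}} → List ℚ → ℚ
amortisedLoad U k ys = sumℚ ys + nℚ (length ys) * 1/ℕ k * U

module _ {U : ℚ} {k : ℕ} .{{_ : NonZero k}} where

  loadBPUP-↭ : ∀ {A B} → A ↭ B → loadBPUP U k A ≡ loadBPUP U k B
  loadBPUP-↭ {[]} {[]} _ = refl
  loadBPUP-↭ {[]} {_ ∷ _} p with () ← PermP.↭-length p
  loadBPUP-↭ {_ ∷ _} {[]} p with () ← PermP.↭-length p
  loadBPUP-↭ {_ ∷ A} {_ ∷ B} p =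
    cong₂ (λ s n → s + nℚ (n ℕ./ k) * U) (sumℚ-↭ p) (ℕP.suc-injective (PermP.↭-length p))

  amortisedLoad-↭ : ∀ {A B} → A ↭ B → amortisedLoad U k A ≡ amortisedLoad U k B
  amortisedLoad-↭ p = cong₂ (λ s n → s + nℚ n * 1/ℕ k * U) (sumℚ-↭ p) (PermP.↭-length p)

  amortisedLoad-++ : ∀ A B → amortisedLoad U k (A ++ B) ≡ amortisedLoad U k A + amortisedLoad U k B
  amortisedLoad-++ A B rewrite sumℚ-++ A B | LP.length-++ A {B} | nℚ-+ (length A) (length B) =
    solve 6 (λ a b m n q u → a :+ b :+ (m :+ n) :* q :* u := (a :+ m :* q :* u) :+ (b :+ n :* q :* u)) refl
      (sumℚ A) (sumℚ B) (nℚ (length A)) (nℚ (length B)) (1/ℕ k) U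

  loadEL-∷ : ∀ E d ds → loadEL U k E (d ∷ ds) ≡ amortisedLoad U k (E ++ d ∷ ds)
  loadEL-∷ E d ds = begin
    sumℚ E + sumℚ (map (_+ U * 1/ℕ k) Λ) + nℚ (length E) * 1/ℕ k * U
      ≡⟨ cong (λ s → sumℚ E + s + nℚ (length E) * 1/ℕ k * U) (sumℚ-map-+ (U * 1/ℕ k) Λ) ⟩
    sumℚ E + (sumℚ Λ + nℚ (length Λ) * (U * 1/ℕ k)) + nℚ (length E) * 1/ℕ k * U
      ≡⟨ solve 6 (λ e l n m q u → e :+ (l :+ n :* (u :* q)) :+ m :* q :* u := (e :+ m :* q :* u) :+ (l :+ n :* q :* u))
               refl (sumℚ E) (sumℚ Λ) (nℚ (length Λ)) (nℚ (length E)) (1/ℕ k) U ⟩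
    amortisedLoad U k E + amortisedLoad U k Λ
      ≡⟨ amortisedLoad-++ E Λ ⟨
    amortisedLoad U k (E ++ Λ) ∎
    where
    open ≡-Reasoning
    Λ = d ∷ ds

module _ {U : ℚ} (0≤U : 0ℚ ≤ U) {k : ℕ} .{{_ : NonZero k}} where

  loadBPUP-mono : ∀ {A B} → A ⊑ B → loadBPUP U k A ≤ loadBPUP U k B
  loadBPUP-mono {[]} {[]} _ = ℚP.≤-refl
  loadBPUP-mono {[]} {B@(_ ∷ B′)} A⊑B = ℚP.≤-trans (sum-≤ A⊑B) (≤-+-0≤ _ (*-nonNeg (nℚ-nonNeg (length B′ ℕ./ k)) 0≤U))
  loadBPUP-mono {_ ∷ _} {[]} A⊑B with () ← length-≤ A⊑B
  loadBPUP-mono {_ ∷ _} {_ ∷ _} A⊑B = ℚP.+-mono-≤ (sum-≤ A⊑B)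
    (*-monoʳ-≤-0≤ 0≤U (nℚ-mono-≤ (ℕD./-monoˡ-≤ k (ℕ.s≤s⁻¹ (length-≤ A⊑B)))))

  amortisedLoad-mono : ∀ {A B} → A ⊑ B → amortisedLoad U k A ≤ amortisedLoad U k B
  amortisedLoad-mono A⊑B = ℚP.+-mono-≤ (sum-≤ A⊑B)
    (*-monoʳ-≤-0≤ 0≤U (*-monoʳ-≤-0≤ (1/ℕ-nonNeg k) (nℚ-mono-≤ (length-≤ A⊑B))))

  loadBPUP≤amortisedLoad : ∀ ys → loadBPUP U k ys ≤ amortisedLoad U k ys
  loadBPUP≤amortisedLoad [] = ≤-+-0≤ _ (*-nonNeg (*-nonNeg (nℚ-nonNeg 0) (1/ℕ-nonNeg k)) 0≤U)
  loadBPUP≤amortisedLoad ys@(_ ∷ ys′) = ℚP.+-monoʳ-≤ (sumℚ ys)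
    (*-monoʳ-≤-0≤ 0≤U (nℚ-≤-*1/ℕ {length ys′ ℕ./ k} {length ys} k (ℕP.≤-trans (ℕD.m/n*n≤m (length ys′) k) (ℕP.n≤1+n (length ys′)))))

  -- Removing k items from a bin pays for the U/k surcharge on every remaining item.
  amortisedLoad≤loadBPUP : ∀ {A B} → A ⊑ B → length A ℕ.+ k ℕ.≤ length B → amortisedLoad U k A ≤ loadBPUP U k B
  amortisedLoad≤loadBPUP {A} {[]} _ A+k≤0 =
    ⊥-elim (ℕP.<-irrefl refl (ℕP.<-≤-trans (ℕ.>-nonZero⁻¹ k) (ℕP.≤-trans (ℕP.m≤n+m k (length A)) A+k≤0)))
  amortisedLoad≤loadBPUP {A} {_ ∷ B} A⊑B A+k≤B = ℚP.+-mono-≤ (sum-≤ A⊑B)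
    (*-monoʳ-≤-0≤ 0≤U (*1/ℕ-≤-nℚ {length B ℕ./ k} {length A} k (m+n≤1+o⇒m≤o/n*n A+k≤B)))

  module _ {m : ℕ} where

    loadBPUP'-light : ∀ {ys} → length ys ℕ.≤ k ℕ.* m → loadBPUP' U k m ys ≡ loadBPUP U k ys
    loadBPUP'-light {ys} ys≤km =
      trans (cong₂ (loadEL U k) (LP.take-all (k ℕ.* m) (sortDesc ys) S≤km) (LP.drop-all (k ℕ.* m) (sortDesc ys) S≤km))
            (loadBPUP-↭ (sortDesc-↭ ys))
      where
      S≤km : length (sortDesc ys) ℕ.≤ k ℕ.* m
      S≤km = ℕP.≤-trans (ℕP.≤-reflexive (sortDesc-length ys)) ys≤km

    loadBPUP'-heavy : ∀ {ys} → k ℕ.* m ℕ.< length ys → loadBPUP' U k m ys ≡ amortisedLoad U k ys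
    loadBPUP'-heavy {ys} km<ys with drop (k ℕ.* m) (sortDesc ys) in eq
    ... | [] = ⊥-elim (ℕP.<⇒≢ (ℕP.m<n⇒0<n∸m km<S) (sym (trans (sym (LP.length-drop (k ℕ.* m) S)) (cong length eq))))
      where
      S = sortDesc ys
      km<S : k ℕ.* m ℕ.< length S
      km<S = ℕP.<-≤-trans km<ys (ℕP.≤-reflexive (sym (sortDesc-length ys)))
    ... | d ∷ ds = begin
      loadEL U k (take (k ℕ.* m) S) (d ∷ ds)          ≡⟨ loadEL-∷ (take (k ℕ.* m) S) d ds ⟩
      amortisedLoad U k (take (k ℕ.* m) S ++ d ∷ ds)  ≡⟨ cong (λ Λ → amortisedLoad U k (take (k ℕ.* m) S ++ Λ)) eq ⟨
      amortisedLoad U k (take (k ℕ.* m) S ++ drop (k ℕ.* m) S)  ≡⟨ cong (amortisedLoad U k) (LP.take++drop≡id (k ℕ.* m) S) ⟩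
      amortisedLoad U k S                             ≡⟨ amortisedLoad-↭ (sortDesc-↭ ys) ⟩
      amortisedLoad U k ys                            ∎
      where
      open ≡-Reasoning
      S = sortDesc ys

    loadBPUP'≤amortisedLoad : ∀ ys → loadBPUP' U k m ys ≤ amortisedLoad U k ys
    loadBPUP'≤amortisedLoad ys with length ys ℕ.≤? k ℕ.* m
    ... | yes light = ℚP.≤-trans (ℚP.≤-reflexive (loadBPUP'-light light)) (loadBPUP≤amortisedLoad ys)
    ... | no heavy = ℚP.≤-reflexive (loadBPUP'-heavy (ℕP.≰⇒> heavy))

    loadBPUP'-mono : ∀ {A B} → A ⊑ B → loadBPUP' U k m A ≤ loadBPUP' U k m B
    loadBPUP'-mono {A} {B} A⊑B with length B ℕ.≤? k ℕ.* m
    ... | yes light = begin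
      loadBPUP' U k m A  ≡⟨ loadBPUP'-light (ℕP.≤-trans (length-≤ A⊑B) light) ⟩
      loadBPUP U k A     ≤⟨ loadBPUP-mono A⊑B ⟩
      loadBPUP U k B     ≡⟨ loadBPUP'-light light ⟨
      loadBPUP' U k m B  ∎
      where open ℚP.≤-Reasoning
    ... | no heavy = begin
      loadBPUP' U k m A    ≤⟨ loadBPUP'≤amortisedLoad A ⟩
      amortisedLoad U k A  ≤⟨ amortisedLoad-mono A⊑B ⟩
      amortisedLoad U k B  ≡⟨ loadBPUP'-heavy (ℕP.≰⇒> heavy) ⟨
      loadBPUP' U k m B    ∎
      where open ℚP.≤-Reasoning

  loadBPUP'≤loadBPUP : ∀ {m A B} → A ⊑ B → length A ℕ.+ k ℕ.≤ length B → loadBPUP' U k m A ≤ loadBPUP U k B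
  loadBPUP'≤loadBPUP {m} {A} A⊑B A+k≤B =
    ℚP.≤-trans (loadBPUP'≤amortisedLoad {m} A) (amortisedLoad≤loadBPUP A⊑B A+k≤B)

take-⊑ : ∀ t {xs} → All NonNeg xs → take t xs ⊑ xs
take-⊑ t {xs} nn = record
  { sum-≤    = ℚP.≤-trans (≤-+-0≤ _ (sumℚ-nonNeg (AllP.drop⁺ t nn)))
                          (ℚP.≤-reflexive (trans (sym (sumℚ-++ (take t xs) (drop t xs))) (cong sumℚ (LP.take++drop≡id t xs))))
  ; length-≤ = ℕP.≤-trans (ℕP.≤-reflexive (LP.length-take t xs)) (ℕP.m⊓n≤n t (length xs)) }

length*sumℚ-suffix≤ : ∀ K R → Desc (K ++ R) → nℚ (length (K ++ R)) * sumℚ R ≤ nℚ (length R) * sumℚ (K ++ R)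
length*sumℚ-suffix≤ K R desc = begin
  nℚ (length (K ++ R)) * sR             ≡⟨ cong (λ n → nℚ n * sR) (LP.length-++ K) ⟩
  nℚ (length K ℕ.+ length R) * sR       ≡⟨ cong (_* sR) (nℚ-+ (length K) (length R)) ⟩
  (nℚ (length K) + nℚ (length R)) * sR  ≡⟨ ℚP.*-distribʳ-+ sR (nℚ (length K)) (nℚ (length R)) ⟩
  nℚ (length K) * sR + nℚ (length R) * sR
    ≤⟨ ℚP.+-monoˡ-≤ _ (length*sumℚ-≤ K R (AllPairs-++⁻ K desc)) ⟩
  nℚ (length R) * sumℚ K + nℚ (length R) * sR  ≡⟨ ℚP.*-distribˡ-+ (nℚ (length R)) (sumℚ K) sR ⟨
  nℚ (length R) * (sumℚ K + sR)         ≡⟨ cong (nℚ (length R) *_) (sumℚ-++ K R) ⟨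
  nℚ (length R) * sumℚ (K ++ R)         ∎
  where
  open ℚP.≤-Reasoning
  sR = sumℚ R

m*sumℚ-suffix≤ : ∀ m K R → Desc (K ++ R) → All NonNeg (K ++ R) →
                 length R ℕ.* m ℕ.≤ length (K ++ R) → nℚ m * sumℚ R ≤ sumℚ (K ++ R)
m*sumℚ-suffix≤ m K [] _ nn _ = ℚP.≤-trans (ℚP.≤-reflexive (ℚP.*-zeroʳ (nℚ m))) (sumℚ-nonNeg nn)
m*sumℚ-suffix≤ m K R@(_ ∷ _) desc nn R*m≤n = *-cancelˡ-≤-0< (nℚ-pos (length R)) (begin
  nℚ (length R) * (nℚ m * sumℚ R)  ≡⟨ ℚP.*-assoc (nℚ (length R)) (nℚ m) (sumℚ R) ⟨
  nℚ (length R) * nℚ m * sumℚ R    ≡⟨ cong (_* sumℚ R) (nℚ-* (length R) m) ⟨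
  nℚ (length R ℕ.* m) * sumℚ R     ≤⟨ *-monoʳ-≤-0≤ (sumℚ-nonNeg (AllP.++⁻ʳ K nn)) (nℚ-mono-≤ R*m≤n) ⟩
  nℚ (length (K ++ R)) * sumℚ R    ≤⟨ length*sumℚ-suffix≤ K R desc ⟩
  nℚ (length R) * sumℚ (K ++ R)    ∎)
  where open ℚP.≤-Reasoning

dropSmallest takeSmallest : ℕ → List ℚ → List ℚ
dropSmallest r b = take (length b ℕ.∸ r) (sortDesc b)
takeSmallest r b = drop (length b ℕ.∸ r) (sortDesc b)

dropSmallest++takeSmallest : ∀ r b → dropSmallest r b ++ takeSmallest r b ≡ sortDesc b
dropSmallest++takeSmallest r b = LP.take++drop≡id (length b ℕ.∸ r) (sortDesc b)

length-dropSmallest : ∀ r b → length (dropSmallest r b) ≡ length b ℕ.∸ r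
length-dropSmallest r b =
  trans (LP.length-take (length b ℕ.∸ r) (sortDesc b))
        (trans (cong ((length b ℕ.∸ r) ℕ.⊓_) (sortDesc-length b)) (ℕP.m≤n⇒m⊓n≡m (ℕP.m∸n≤m (length b) r)))

length-takeSmallest : ∀ r b → r ℕ.≤ length b → length (takeSmallest r b) ≡ r
length-takeSmallest r b r≤b =
  trans (LP.length-drop (length b ℕ.∸ r) (sortDesc b))
        (trans (cong (ℕ._∸ (length b ℕ.∸ r)) (sortDesc-length b)) (ℕP.m∸[m∸n]≡n r≤b))

takeSmallest-zero : ∀ b → takeSmallest 0 b ≡ []
takeSmallest-zero b = LP.drop-all (length b) (sortDesc b) (ℕP.≤-reflexive (sortDesc-length b))

dropSmallest-⊑ : ∀ r {b} → All NonNeg b → dropSmallest r b ⊑ b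
dropSmallest-⊑ r {b} nn =
  ⊑-trans (take-⊑ (length b ℕ.∸ r) (PermP.All-resp-↭ (↭-sym (sortDesc-↭ b)) nn)) (↭⇒⊑ (sortDesc-↭ b))

m*sumℚ-takeSmallest≤ : ∀ m .{{_ : NonZero m}} r {b} → All NonNeg b → r ℕ.* m ℕ.≤ length b →
                       nℚ m * sumℚ (takeSmallest r b) ≤ sumℚ b
m*sumℚ-takeSmallest≤ m r {b} nn r*m≤b = begin
  nℚ m * sumℚ (takeSmallest r b)  ≤⟨ m*sumℚ-suffix≤ m (dropSmallest r b) (takeSmallest r b) desc nnS R*m≤S ⟩
  sumℚ (dropSmallest r b ++ takeSmallest r b)  ≡⟨ cong sumℚ (dropSmallest++takeSmallest r b) ⟩
  sumℚ (sortDesc b)               ≡⟨ sumℚ-↭ (sortDesc-↭ b) ⟩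
  sumℚ b                          ∎
  where
  open ℚP.≤-Reasoning
  S≡ = dropSmallest++takeSmallest r b
  desc = subst Desc (sym S≡) (sortDesc-desc b)
  nnS = subst (All NonNeg) (sym S≡) (PermP.All-resp-↭ (↭-sym (sortDesc-↭ b)) nn)
  r≤b = ℕP.≤-trans (ℕP.m≤m*n r m) r*m≤b
  R*m≤S : length (takeSmallest r b) ℕ.* m ℕ.≤ length (dropSmallest r b ++ takeSmallest r b)
  R*m≤S = subst₂ ℕ._≤_ (cong (ℕ._* m) (sym (length-takeSmallest r b r≤b)))
                        (sym (trans (cong length S≡) (sortDesc-length b))) r*m≤b

groups : ∀ {A : Set} → ℕ → ℕ → List A → List (List A)
groups m zero    xs = []
groups m (suc c) xs = take m xs ∷ groups m c (drop m xs)

length-groups : ∀ {A : Set} m c (xs : List A) → length (groups m c xs) ≡ c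
length-groups m zero    xs = refl
length-groups m (suc c) xs = cong suc (length-groups m c (drop m xs))

concat-groups : ∀ {A : Set} m c (xs : List A) → length xs ℕ.≤ c ℕ.* m → concat (groups m c xs) ≡ xs
concat-groups m zero    []       _ = refl
concat-groups m (suc c) xs xs≤ = begin
  take m xs ++ concat (groups m c (drop m xs))  ≡⟨ cong (take m xs ++_) (concat-groups m c (drop m xs) drop≤) ⟩
  take m xs ++ drop m xs                        ≡⟨ LP.take++drop≡id m xs ⟩
  xs                                            ∎
  where
  open ≡-Reasoning
  drop≤ : length (drop m xs) ℕ.≤ c ℕ.* m
  drop≤ = ℕP.≤-trans (ℕP.≤-reflexive (LP.length-drop m xs))
            (ℕP.≤-trans (ℕP.∸-monoˡ-≤ m xs≤) (ℕP.≤-reflexive (ℕP.m+n∸m≡n m (c ℕ.* m))))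

groups-length≤ : ∀ {A : Set} m c (xs : List A) → All (λ g → length g ℕ.≤ m) (groups m c xs)
groups-length≤ m zero    xs = []
groups-length≤ m (suc c) xs =
  ℕP.≤-trans (ℕP.≤-reflexive (LP.length-take m xs)) (ℕP.m⊓n≤m m (length xs)) ∷ groups-length≤ m c (drop m xs)

All-groups : ∀ {A : Set} {P : A → Set} m c {xs} → All P xs → All (All P) (groups m c xs)
All-groups m zero    pxs = []
All-groups m (suc c) pxs = AllP.take⁺ m pxs ∷ All-groups m c (AllP.drop⁺ m pxs)

length-concat≤ : ∀ {A : Set} k {xss : List (List A)} → All (λ xs → length xs ℕ.≤ k) xss →
                 length (concat xss) ℕ.≤ k ℕ.* length xss
length-concat≤ k [] = ℕ.z≤n
length-concat≤ k {xs ∷ xss} (xs≤k ∷ xss≤k) = begin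
  length (xs ++ concat xss)         ≡⟨ LP.length-++ xs ⟩
  length xs ℕ.+ length (concat xss) ≤⟨ ℕP.+-mono-≤ xs≤k (length-concat≤ k xss≤k) ⟩
  k ℕ.+ k ℕ.* length xss            ≡⟨ ℕP.*-suc k (length xss) ⟨
  k ℕ.* suc (length xss)            ∎
  where open ℕP.≤-Reasoning

concat-map-++-↭ : ∀ {A : Set} (f g : List A → List A) → (∀ xs → f xs ++ g xs ↭ xs) →
                  ∀ xss → concat (map f xss) ++ concat (map g xss) ↭ concat xss
concat-map-++-↭ f g fg↭ [] = ↭-refl
concat-map-++-↭ f g fg↭ (xs ∷ xss) = begin
  (f xs ++ concat (map f xss)) ++ g xs ++ concat (map g xss)  ≡⟨ LP.++-assoc (f xs) _ _ ⟩
  f xs ++ concat (map f xss) ++ g xs ++ concat (map g xss)    ↭⟨ PermP.++⁺ˡ (f xs) (PermP.shifts (concat (map f xss)) (g xs)) ⟩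
  f xs ++ g xs ++ concat (map f xss) ++ concat (map g xss)    ≡⟨ LP.++-assoc (f xs) (g xs) _ ⟨
  (f xs ++ g xs) ++ concat (map f xss) ++ concat (map g xss)  ↭⟨ PermP.++⁺ (fg↭ xs) (concat-map-++-↭ f g fg↭ xss) ⟩
  xs ++ concat xss                                            ∎
  where open PermutationReasoning

m≤[m/n+1]*n : ∀ m n .{{_ : NonZero n}} → m ℕ.≤ (m ℕ./ n ℕ.+ 1) ℕ.* n
m≤[m/n+1]*n m n = begin
  m                              ≡⟨ ℕD.m≡m%n+[m/n]*n m n ⟩
  m ℕ.% n ℕ.+ (m ℕ./ n) ℕ.* n    ≤⟨ ℕP.+-monoˡ-≤ _ (ℕD.m%n≤n m n) ⟩
  n ℕ.+ (m ℕ./ n) ℕ.* n          ≡⟨ ℕP.+-comm n _ ⟩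
  (m ℕ./ n) ℕ.* n ℕ.+ n          ≡⟨ cong ((m ℕ./ n) ℕ.* n ℕ.+_) (ℕP.*-identityˡ n) ⟨
  (m ℕ./ n) ℕ.* n ℕ.+ 1 ℕ.* n    ≡⟨ ℕP.*-distribʳ-+ n (m ℕ./ n) 1 ⟨
  (m ℕ./ n ℕ.+ 1) ℕ.* n          ∎
  where open ℕP.≤-Reasoning

-- Bounding the amortised load per item rather than per removed block makes this closed under ++.
LowDensity : (U : ℚ) (k m : ℕ) .{{_ : NonZero k}} → List ℚ → Set
LowDensity U k m R = nℚ m * amortisedLoad U k R ≤ nℚ (length R) * 1/ℕ k

removedCount : (k m : ℕ) → List ℚ → ℕ
removedCount k m b with length b ℕ.≤? k ℕ.* m
... | yes _ = 0
... | no _ = k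

removedCount-cases : ∀ k m b → (length b ℕ.≤ k ℕ.* m × removedCount k m b ≡ 0)
                             ⊎ (k ℕ.* m ℕ.< length b × removedCount k m b ≡ k)
removedCount-cases k m b with length b ℕ.≤? k ℕ.* m
... | yes light = inj₁ (light , refl)
... | no heavy = inj₂ (ℕP.≰⇒> heavy , refl)

keptPart removedPart : (k m : ℕ) → List ℚ → List ℚ
keptPart k m b = dropSmallest (removedCount k m b) b
removedPart k m b = takeSmallest (removedCount k m b) b

module _ (k m : ℕ) .{{_ : NonZero m}} where

  repack : List (List ℚ) → List (List ℚ)
  repack B = map (keptPart k m) B ++ map concat (groups m (length B ℕ./ m ℕ.+ 1) (map (removedPart k m) B))

  length-repack : ∀ B → length (repack B) ≡ length B ℕ.+ (length B ℕ./ m ℕ.+ 1)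
  length-repack B = trans (LP.length-++ (map (keptPart k m) B))
    (cong₂ ℕ._+_ (LP.length-map (keptPart k m) B)
                 (trans (LP.length-map concat (groups m c Rs)) (length-groups m c Rs)))
    where
    c = length B ℕ./ m ℕ.+ 1
    Rs = map (removedPart k m) B

  concat-repack-↭ : ∀ B → concat (repack B) ↭ concat B
  concat-repack-↭ B = begin
    concat (map (keptPart k m) B ++ map concat G)               ≡⟨ LP.concat-++ (map (keptPart k m) B) (map concat G) ⟨
    concat (map (keptPart k m) B) ++ concat (map concat G)      ≡⟨ cong (concat (map (keptPart k m) B) ++_) (LP.concat-concat G) ⟩
    concat (map (keptPart k m) B) ++ concat (concat G)          ≡⟨ cong (λ Rs → concat (map (keptPart k m) B) ++ concat Rs) concatG ⟩
    concat (map (keptPart k m) B) ++ concat (map (removedPart k m) B)  ↭⟨ concat-map-++-↭ (keptPart k m) (removedPart k m) (λ b → ↭-trans (↭-reflexive (dropSmallest++takeSmallest (removedCount k m b) b)) (sortDesc-↭ b)) B ⟩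
    concat B                                                    ∎
    where
    open PermutationReasoning
    Rs = map (removedPart k m) B
    G = groups m (length B ℕ./ m ℕ.+ 1) Rs
    concatG : concat G ≡ Rs
    concatG = concat-groups m (length B ℕ./ m ℕ.+ 1) Rs
      (subst (ℕ._≤ (length B ℕ./ m ℕ.+ 1) ℕ.* m) (sym (LP.length-map (removedPart k m) B)) (m≤[m/n+1]*n (length B) m))

module _ {U : ℚ} (0≤U : 0ℚ ≤ U) {k m : ℕ} .{{_ : NonZero k}} .{{_ : NonZero m}} where

  LowDensity-[] : LowDensity U k m []
  LowDensity-[] = ℚP.≤-reflexive
    (solve 3 (λ m q u → m :* (con 0ℚ :+ con 0ℚ :* q :* u) := con 0ℚ :* q) refl (nℚ m) (1/ℕ k) U)

  LowDensity-++ : ∀ {A B} → LowDensity U k m A → LowDensity U k m B → LowDensity U k m (A ++ B)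
  LowDensity-++ {A} {B} dA dB = begin
    nℚ m * amortisedLoad U k (A ++ B)  ≡⟨ cong (nℚ m *_) (amortisedLoad-++ A B) ⟩
    nℚ m * (amortisedLoad U k A + amortisedLoad U k B)
      ≡⟨ ℚP.*-distribˡ-+ (nℚ m) (amortisedLoad U k A) (amortisedLoad U k B) ⟩
    nℚ m * amortisedLoad U k A + nℚ m * amortisedLoad U k B  ≤⟨ ℚP.+-mono-≤ dA dB ⟩
    nℚ (length A) * 1/ℕ k + nℚ (length B) * 1/ℕ k  ≡⟨ ℚP.*-distribʳ-+ (1/ℕ k) (nℚ (length A)) (nℚ (length B)) ⟨
    (nℚ (length A) + nℚ (length B)) * 1/ℕ k        ≡⟨ cong (_* 1/ℕ k) (nℚ-+ (length A) (length B)) ⟨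
    nℚ (length A ℕ.+ length B) * 1/ℕ k             ≡⟨ cong (λ n → nℚ n * 1/ℕ k) (LP.length-++ A) ⟨
    nℚ (length (A ++ B)) * 1/ℕ k                   ∎
    where open ℚP.≤-Reasoning

  LowDensity-concat : ∀ {Rs} → All (LowDensity U k m) Rs → LowDensity U k m (concat Rs)
  LowDensity-concat [] = LowDensity-[]
  LowDensity-concat {R ∷ Rs} (dR ∷ dRs) = LowDensity-++ {R} {concat Rs} dR (LowDensity-concat dRs)

  LowDensity⇒loadBPUP'≤1 : ∀ {X} → LowDensity U k m X → length X ℕ.≤ k ℕ.* m → loadBPUP' U k m X ≤ 1ℚ
  LowDensity⇒loadBPUP'≤1 {X} dX X≤km = *-cancelˡ-≤-0< (nℚ-pos m) (begin
    nℚ m * loadBPUP' U k m X      ≤⟨ *-monoˡ-≤-0≤ (nℚ-nonNeg m) (loadBPUP'≤amortisedLoad 0≤U X) ⟩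
    nℚ m * amortisedLoad U k X    ≤⟨ dX ⟩
    nℚ (length X) * 1/ℕ k         ≤⟨ *1/ℕ-≤-nℚ {m} {length X} k (subst (length X ℕ.≤_) (ℕP.*-comm k m) X≤km) ⟩
    nℚ m                          ≡⟨ ℚP.*-identityʳ (nℚ m) ⟨
    nℚ m * 1ℚ                     ∎)
    where open ℚP.≤-Reasoning

  takeSmallest-lowDensity : ∀ {b} → All NonNeg b → k ℕ.* m ℕ.< length b → loadBPUP U k b ≤ 1ℚ →
                            LowDensity U k m (takeSmallest k b)
  takeSmallest-lowDensity {b@(_ ∷ b′)} nn km<b load≤1 = begin
    nℚ m * amortisedLoad U k R                  ≡⟨ cong (λ n → nℚ m * (sumℚ R + nℚ n * 1/ℕ k * U)) lengthR ⟩
    nℚ m * (sumℚ R + nℚ k * 1/ℕ k * U)          ≡⟨ cong (λ c → nℚ m * (sumℚ R + c * U)) (nℚ*1/ℕ≡1 k) ⟩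
    nℚ m * (sumℚ R + 1ℚ * U)                    ≡⟨ solve 3 (λ m s u → m :* (s :+ con 1ℚ :* u) := m :* s :+ m :* u) refl (nℚ m) (sumℚ R) U ⟩
    nℚ m * sumℚ R + nℚ m * U                    ≤⟨ ℚP.+-mono-≤ (m*sumℚ-takeSmallest≤ m k nn (ℕP.<⇒≤ km<b))
                                                                (*-monoʳ-≤-0≤ 0≤U (nℚ-mono-≤ m≤b′/k)) ⟩
    loadBPUP U k b                              ≤⟨ load≤1 ⟩
    1ℚ                                          ≡⟨ nℚ*1/ℕ≡1 k ⟨
    nℚ k * 1/ℕ k                                ≡⟨ cong (λ n → nℚ n * 1/ℕ k) lengthR ⟨
    nℚ (length R) * 1/ℕ k                       ∎
    where
    open ℚP.≤-Reasoning
    R = takeSmallest k b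
    lengthR = length-takeSmallest k b (ℕP.≤-trans (ℕP.m≤m*n k m) (ℕP.<⇒≤ km<b))
    m≤b′/k : m ℕ.≤ length b′ ℕ./ k
    m≤b′/k = ℕP.≤-trans (ℕP.≤-reflexive (sym (ℕD.m*n/n≡m m k)))
               (ℕD./-monoˡ-≤ k (ℕP.≤-trans (ℕP.≤-reflexive (ℕP.*-comm m k)) (ℕ.s≤s⁻¹ km<b)))

  keptPart-feasible : ∀ {b} → All NonNeg b → loadBPUP U k b ≤ 1ℚ → loadBPUP' U k m (keptPart k m b) ≤ 1ℚ
  keptPart-feasible {b} nn load≤1 with removedCount-cases k m b
  ... | inj₁ (light , r≡0) rewrite r≡0 = begin
    loadBPUP' U k m (dropSmallest 0 b)  ≤⟨ loadBPUP'-mono 0≤U (dropSmallest-⊑ 0 nn) ⟩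
    loadBPUP' U k m b                   ≡⟨ loadBPUP'-light 0≤U light ⟩
    loadBPUP U k b                      ≤⟨ load≤1 ⟩
    1ℚ                                  ∎
    where open ℚP.≤-Reasoning
  ... | inj₂ (heavy , r≡k) rewrite r≡k = ℚP.≤-trans (loadBPUP'≤loadBPUP 0≤U (dropSmallest-⊑ k nn) kept+k≤b) load≤1
    where
    kept+k≤b : length (dropSmallest k b) ℕ.+ k ℕ.≤ length b
    kept+k≤b = ℕP.≤-reflexive (trans (cong (ℕ._+ k) (length-dropSmallest k b))
                                     (ℕP.m∸n+n≡m (ℕP.≤-trans (ℕP.m≤m*n k m) (ℕP.<⇒≤ heavy))))

  removedPart-lowDensity : ∀ {b} → All NonNeg b → loadBPUP U k b ≤ 1ℚ → LowDensity U k m (removedPart k m b)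
  removedPart-lowDensity {b} nn load≤1 with removedCount-cases k m b
  ... | inj₁ (_ , r≡0) rewrite r≡0 | takeSmallest-zero b = LowDensity-[]
  ... | inj₂ (heavy , r≡k) rewrite r≡k = takeSmallest-lowDensity nn heavy load≤1

  length-removedPart : ∀ b → length (removedPart k m b) ℕ.≤ k
  length-removedPart b with removedCount-cases k m b
  ... | inj₁ (_ , r≡0) rewrite r≡0 | takeSmallest-zero b = ℕ.z≤n
  ... | inj₂ (heavy , r≡k) rewrite r≡k =
    ℕP.≤-reflexive (length-takeSmallest k b (ℕP.≤-trans (ℕP.m≤m*n k m) (ℕP.<⇒≤ heavy)))

  repack-feasible : ∀ {B} → All (λ b → All NonNeg b × loadBPUP U k b ≤ 1ℚ) B →
                    All (λ b → loadBPUP' U k m b ≤ 1ℚ) (repack k m B)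
  repack-feasible {B} ok =
    AllP.++⁺ (AllP.map⁺ (All.map kept-feasible ok))
             (AllP.map⁺ (All.map group-feasible (All.zip (All-groups m c (AllP.map⁺ (All.map part-ok ok)) , groups-length≤ m c Rs))))
    where
    c = length B ℕ./ m ℕ.+ 1
    Rs = map (removedPart k m) B
    Part : List ℚ → Set
    Part R = LowDensity U k m R × length R ℕ.≤ k
    kept-feasible : ∀ {b} → All NonNeg b × loadBPUP U k b ≤ 1ℚ → loadBPUP' U k m (keptPart k m b) ≤ 1ℚ
    kept-feasible (nn , load≤1) = keptPart-feasible nn load≤1
    part-ok : ∀ {b} → All NonNeg b × loadBPUP U k b ≤ 1ℚ → Part (removedPart k m b)
    part-ok {b} (nn , load≤1) = removedPart-lowDensity nn load≤1 , length-removedPart b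
    group-feasible : ∀ {g} → All Part g × length g ℕ.≤ m → loadBPUP' U k m (concat g) ≤ 1ℚ
    group-feasible (parts , g≤m) = LowDensity⇒loadBPUP'≤1 (LowDensity-concat (All.map proj₁ parts))
      (ℕP.≤-trans (length-concat≤ k (All.map proj₂ parts)) (ℕP.*-monoʳ-≤ k g≤m))

filter-map : ∀ {A B : Set} {P : B → Set} (P? : ∀ y → Dec (P y)) (g : A → B) xs →
             filter P? (map g xs) ≡ map g (filter (P? ∘ g) xs)
filter-map P? g [] = refl
filter-map P? g (x ∷ xs) with does (P? (g x))
... | true  = cong (g x ∷_) (filter-map P? g xs)
... | false = filter-map P? g xs

map-lookup-filter-suc : ∀ {c} x xs (f : Fin (suc (length xs)) → Fin c) j →
                        map (L.lookup (x ∷ xs)) (filter (λ i → f i Fin.≟ j) (tabulate suc))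
                        ≡ binContents xs (f ∘ suc) j
map-lookup-filter-suc x xs f j = begin
  map (L.lookup (x ∷ xs)) (filter P? (tabulate suc))                  ≡⟨ cong (map (L.lookup (x ∷ xs)) ∘ filter P?) (LP.map-tabulate id suc) ⟨
  map (L.lookup (x ∷ xs)) (filter P? (map suc (L.allFin (length xs))))  ≡⟨ cong (map (L.lookup (x ∷ xs))) (filter-map P? suc (L.allFin (length xs))) ⟩
  map (L.lookup (x ∷ xs)) (map suc (filter (P? ∘ suc) (L.allFin (length xs))))  ≡⟨ LP.map-∘ (filter (P? ∘ suc) (L.allFin (length xs))) ⟨
  binContents xs (f ∘ suc) j                                          ∎
  where
  open ≡-Reasoning
  P? = λ i → f i Fin.≟ j

binContents-∷ : ∀ {c} x xs (f : Fin (suc (length xs)) → Fin c) j →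
                binContents (x ∷ xs) f j ≡ consIf (does (f zero Fin.≟ j)) x (binContents xs (f ∘ suc) j)
binContents-∷ x xs f j with does (f zero Fin.≟ j)
... | true  = cong (x ∷_) (map-lookup-filter-suc x xs f j)
... | false = map-lookup-filter-suc x xs f j

binContents-∷∷ : ∀ {c} x y xs (f : Fin (suc (suc (length xs))) → Fin c) j →
                 binContents (x ∷ y ∷ xs) f j
                 ≡ consIf (does (f zero Fin.≟ j)) x (consIf (does (f (suc zero) Fin.≟ j)) y (binContents xs (f ∘ Fin.suc ∘ Fin.suc) j))
binContents-∷∷ x y xs f j =
  trans (binContents-∷ x (y ∷ xs) f j) (cong (consIf (does (f zero Fin.≟ j)) x) (binContents-∷ y xs (f ∘ Fin.suc) j))

binContents-suc-zero : ∀ {c} xs (g : Fin (length xs) → Fin c) → binContents xs (Fin.suc ∘ g) zero ≡ []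
binContents-suc-zero [] g = refl
binContents-suc-zero (x ∷ xs) g = trans (binContents-∷ x xs (Fin.suc ∘ g) zero) (binContents-suc-zero xs (g ∘ Fin.suc))

binContents-suc : ∀ {c} xs (g : Fin (length xs) → Fin c) j → binContents xs (Fin.suc ∘ g) (suc j) ≡ binContents xs g j
binContents-suc [] g j = refl
binContents-suc (x ∷ xs) g j = begin
  binContents (x ∷ xs) (Fin.suc ∘ g) (suc j)                                    ≡⟨ binContents-∷ x xs (Fin.suc ∘ g) (suc j) ⟩
  consIf (does (g zero Fin.≟ j)) x (binContents xs (Fin.suc ∘ g ∘ Fin.suc) (suc j))  ≡⟨ cong (consIf _ x) (binContents-suc xs (g ∘ Fin.suc) j) ⟩
  consIf (does (g zero Fin.≟ j)) x (binContents xs (g ∘ Fin.suc) j)              ≡⟨ binContents-∷ x xs g j ⟨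
  binContents (x ∷ xs) g j                                                  ∎
  where open ≡-Reasoning

binContents-cong : ∀ {c} xs {f g : Fin (length xs) → Fin c} → (∀ i → f i ≡ g i) → ∀ j → binContents xs f j ≡ binContents xs g j
binContents-cong xs f≗g j = cong (map (L.lookup xs))
  (LP.filter-≐ (λ i → _ Fin.≟ j) (λ i → _ Fin.≟ j) ((λ {i} p → trans (sym (f≗g i)) p) , (λ {i} p → trans (f≗g i) p)) (L.allFin (length xs)))

concat-tabulate-consIf : ∀ {c} (t : Fin c) x (F : Fin c → List ℚ) →
                         concat (tabulate (λ j → consIf (does (t Fin.≟ j)) x (F j))) ↭ x ∷ concat (tabulate F)
concat-tabulate-consIf zero    x F = ↭-refl
concat-tabulate-consIf (suc t) x F = ↭-trans (PermP.++⁺ˡ (F zero) (concat-tabulate-consIf t x (F ∘ Fin.suc)))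
                                             (PermP.shift x (F zero) (concat (tabulate (F ∘ Fin.suc))))

concat-tabulate-[] : ∀ c → concat (tabulate {n = c} (λ _ → [] {A = ℚ})) ≡ []
concat-tabulate-[] zero    = refl
concat-tabulate-[] (suc c) = concat-tabulate-[] c

concat-binContents-↭ : ∀ xs {c} (f : Fin (length xs) → Fin c) → concat (tabulate (binContents xs f)) ↭ xs
concat-binContents-↭ [] {c} f = ↭-reflexive (concat-tabulate-[] c)
concat-binContents-↭ (x ∷ xs) f = begin
  concat (tabulate (binContents (x ∷ xs) f))  ≡⟨ cong concat (LP.tabulate-cong (binContents-∷ x xs f)) ⟩
  concat (tabulate (λ j → consIf (does (f zero Fin.≟ j)) x (binContents xs (f ∘ Fin.suc) j)))
    ↭⟨ concat-tabulate-consIf (f zero) x (binContents xs (f ∘ Fin.suc)) ⟩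
  x ∷ concat (tabulate (binContents xs (f ∘ Fin.suc)))  <⟨ concat-binContents-↭ xs (f ∘ Fin.suc) ⟩
  x ∷ xs                                            ∎
  where open PermutationReasoning

appendIf : Bool → List ℚ → List ℚ → List ℚ
appendIf c xs ys = if c then xs ++ ys else ys

assignPrefix : ∀ {c} xs {ys : List ℚ} → Fin c → (Fin (length ys) → Fin c) → Fin (length (xs ++ ys)) → Fin c
assignPrefix []       t g = g
assignPrefix (x ∷ xs) t g = t Vector.∷ assignPrefix xs t g

binContents-assignPrefix : ∀ {c} xs {ys} (t : Fin c) (g : Fin (length ys) → Fin c) j →
                           binContents (xs ++ ys) (assignPrefix xs t g) j ≡ appendIf (does (t Fin.≟ j)) xs (binContents ys g j)
binContents-assignPrefix [] t g j with does (t Fin.≟ j)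
... | true  = refl
... | false = refl
binContents-assignPrefix (x ∷ xs) {ys} t g j =
  trans (binContents-∷ x (xs ++ ys) (t Vector.∷ assignPrefix xs t g) j)
        (trans (cong (consIf (does (t Fin.≟ j)) x) (binContents-assignPrefix xs t g j)) (consIf-appendIf (does (t Fin.≟ j))))
  where
  consIf-appendIf : ∀ d → consIf d x (appendIf d xs (binContents ys g j)) ≡ appendIf d (x ∷ xs) (binContents ys g j)
  consIf-appendIf true  = refl
  consIf-appendIf false = refl

concatAssignment : (B : List (List ℚ)) → Fin (length (concat B)) → Fin (length B)
concatAssignment []      ()
concatAssignment (b ∷ B) = assignPrefix b zero (Fin.suc ∘ concatAssignment B)

binContents-concatAssignment : ∀ B j → binContents (concat B) (concatAssignment B) j ≡ L.lookup B j
binContents-concatAssignment (b ∷ B) zero = begin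
  binContents (b ++ concat B) (concatAssignment (b ∷ B)) zero  ≡⟨ binContents-assignPrefix b zero (Fin.suc ∘ concatAssignment B) zero ⟩
  b ++ binContents (concat B) (Fin.suc ∘ concatAssignment B) zero  ≡⟨ cong (b ++_) (binContents-suc-zero (concat B) (concatAssignment B)) ⟩
  b ++ []                                                      ≡⟨ LP.++-identityʳ b ⟩
  b                                                            ∎
  where open ≡-Reasoning
binContents-concatAssignment (b ∷ B) (suc j) = begin
  binContents (b ++ concat B) (concatAssignment (b ∷ B)) (suc j)  ≡⟨ binContents-assignPrefix b zero (Fin.suc ∘ concatAssignment B) (suc j) ⟩
  binContents (concat B) (Fin.suc ∘ concatAssignment B) (suc j)       ≡⟨ binContents-suc (concat B) (concatAssignment B) j ⟩
  binContents (concat B) (concatAssignment B) j                   ≡⟨ binContents-concatAssignment B j ⟩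
  L.lookup B j                                                    ∎
  where open ≡-Reasoning

infix 4 _⊑ₚ_
record _⊑ₚ_ (ys xs : List ℚ) : Set where
  constructor transfer
  field
    transferAssignment : ∀ {c} (f : Fin (length xs) → Fin c) →
                         Σ (Fin (length ys) → Fin c) λ g → ∀ j → binContents ys g j ⊑ binContents xs f j
open _⊑ₚ_

⊑ₚ-refl : ∀ {xs} → xs ⊑ₚ xs
⊑ₚ-refl = transfer λ f → f , λ j → ⊑-refl

⊑ₚ-trans : ∀ {zs ys xs} → zs ⊑ₚ ys → ys ⊑ₚ xs → zs ⊑ₚ xs
⊑ₚ-trans zs⊑ys ys⊑xs = transfer λ f →
  let g , g⊑f = transferAssignment ys⊑xs f
      h , h⊑g = transferAssignment zs⊑ys g
  in h , λ j → ⊑-trans (h⊑g j) (g⊑f j)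

⊑ₚ-∷ : ∀ {y x ys xs} → y ≤ x → ys ⊑ₚ xs → y ∷ ys ⊑ₚ x ∷ xs
⊑ₚ-∷ {y} {x} {ys} {xs} y≤x ys⊑xs = transfer λ f →
  let g , g⊑ = transferAssignment ys⊑xs (f ∘ Fin.suc)
  in f zero Vector.∷ g , λ j →
     subst₂ _⊑_ (sym (binContents-∷ y ys (f zero Vector.∷ g) j)) (sym (binContents-∷ x xs f j))
            (⊑-consIf (does (f zero Fin.≟ j)) y≤x (g⊑ j))

⊑ₚ-∷ʳ : ∀ {x ys xs} → 0ℚ ≤ x → ys ⊑ₚ xs → ys ⊑ₚ x ∷ xs
⊑ₚ-∷ʳ {x} {ys} {xs} 0≤x ys⊑xs = transfer λ f →
  let g , g⊑ = transferAssignment ys⊑xs (f ∘ Fin.suc)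
  in g , λ j → subst (binContents ys g j ⊑_) (sym (binContents-∷ x xs f j))
                     (⊑-consIfʳ (does (f zero Fin.≟ j)) 0≤x (g⊑ j))

⊑ₚ-swap : ∀ {x y ys xs} → ys ⊑ₚ xs → x ∷ y ∷ ys ⊑ₚ y ∷ x ∷ xs
⊑ₚ-swap {x} {y} {ys} {xs} ys⊑xs = transfer λ f →
  let g , g⊑ = transferAssignment ys⊑xs (f ∘ Fin.suc ∘ Fin.suc)
      h = f (suc zero) Vector.∷ f zero Vector.∷ g
  in h , λ j →
     subst₂ _⊑_ (sym (binContents-∷∷ x y ys h j)) (sym (binContents-∷∷ y x xs f j))
            (⊑-consIf-swap (does (f (suc zero) Fin.≟ j)) (does (f zero Fin.≟ j)) (g⊑ j))

↭⇒⊑ₚ : ∀ {ys xs} → ys ↭ xs → ys ⊑ₚ xs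
↭⇒⊑ₚ ↭.refl         = ⊑ₚ-refl
↭⇒⊑ₚ (↭.prep x p)   = ⊑ₚ-∷ ℚP.≤-refl (↭⇒⊑ₚ p)
↭⇒⊑ₚ (↭.swap x y p) = ⊑ₚ-swap (↭⇒⊑ₚ p)
↭⇒⊑ₚ (↭.trans p q)  = ⊑ₚ-trans (↭⇒⊑ₚ p) (↭⇒⊑ₚ q)

module _ {U : ℚ} (0≤U : 0ℚ ≤ U) {k : ℕ} .{{_ : NonZero k}} where

  FeasibleBPUP⇒bins : ∀ {xs ys c} → ys ⊑ₚ xs → All NonNeg ys → FeasibleBPUP U k xs c →
                      Σ (List (List ℚ)) λ B → concat B ↭ ys × length B ≡ c × All (λ b → All NonNeg b × loadBPUP U k b ≤ 1ℚ) B
  FeasibleBPUP⇒bins {ys = ys} ys⊑xs nn (f , f-feasible) =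
    let g , g⊑f = transferAssignment ys⊑xs f
        B = tabulate (binContents ys g)
        concatB↭ys = concat-binContents-↭ ys g
        bins-nonNeg = AllP.concat⁻ (PermP.All-resp-↭ (↭-sym concatB↭ys) nn)
        bins-feasible = AllP.tabulate⁺ (λ j → ℚP.≤-trans (loadBPUP-mono 0≤U (g⊑f j)) (f-feasible j))
    in B , concatB↭ys , LP.length-tabulate (binContents ys g) , All.zip (bins-nonNeg , bins-feasible)

  bins⇒FeasibleBPUP' : ∀ {m ys} B → ys ↭ concat B → All (λ b → loadBPUP' U k m b ≤ 1ℚ) B →
                       FeasibleBPUP' U k m ys (length B)
  bins⇒FeasibleBPUP' {ys = ys} B ys↭B B-feasible =
    let g , g⊑ = transferAssignment (↭⇒⊑ₚ ys↭B) (concatAssignment B)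
    in g , λ j → ℚP.≤-trans (loadBPUP'-mono 0≤U (subst (binContents ys g j ⊑_) (binContents-concatAssignment B j) (g⊑ j)))
                            (All.lookup B-feasible (∈-lookup {xs = B} j))

Σ-Fin→Fin? : ∀ n {c} (P : (Fin n → Fin c) → Set) → (∀ {f g} → (∀ i → f i ≡ g i) → P f → P g) →
             (∀ f → Dec (P f)) → Dec (Σ (Fin n → Fin c) P)
Σ-Fin→Fin? zero P resp P? with P? (λ ())
... | yes p = yes ((λ ()) , p)
... | no ¬p = no λ (f , pf) → ¬p (resp (λ ()) pf)
Σ-Fin→Fin? (suc n) P resp P?
  with FinP.any? (λ a → Σ-Fin→Fin? n (λ g → P (a Vector.∷ g)) (λ g≗h → resp (λ { zero → refl ; (suc i) → g≗h i })) (λ g → P? (a Vector.∷ g)))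
... | yes (a , g , p) = yes (a Vector.∷ g , p)
... | no ¬p = no λ (f , pf) → ¬p (f zero , f ∘ Fin.suc , resp (λ { zero → refl ; (suc i) → refl }) pf)

Least : (ℕ → Set) → Set
Least P = Σ ℕ λ b → P b × (∀ b′ → P b′ → b ℕ.≤ b′)

least : ∀ {P : ℕ → Set} → (∀ n → Dec (P n)) → ∀ {n} → P n → Least P
least {P} P? {n} = <-rec (λ n → P n → Least P) step n
  where
  open import Data.Nat.Induction using (<-rec)
  step : ∀ n → (∀ {m} → m ℕ.< n → P m → Least P) → P n → Least P
  step n smaller pn with ℕP.anyUpTo? P? n
  ... | yes (m , m<n , pm) = smaller m<n pm
  ... | no none-below = n , pn , λ b′ pb′ → ℕP.≮⇒≥ λ b′<n → none-below (b′ , b′<n , pb′)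

module _ {U : ℚ} {k m : ℕ} .{{_ : NonZero k}} where

  feasibleBPUP'? : ∀ ys c → Dec (FeasibleBPUP' U k m ys c)
  feasibleBPUP'? ys c = Σ-Fin→Fin? (length ys) _
    (λ f≗g f-feasible j → subst (λ b → loadBPUP' U k m b ≤ 1ℚ) (binContents-cong ys f≗g j) (f-feasible j))
    (λ f → FinP.all? λ j → loadBPUP' U k m (binContents ys f j) ℚP.≤? 1ℚ)

  optBPUP'-exists : ∀ ys {c} → FeasibleBPUP' U k m ys c → Σ ℕ (IsOptBPUP' U k m ys)
  optBPUP'-exists ys feasible = least (feasibleBPUP'? ys) feasible

infix 4 _≼_
data _≼_ : List ℚ → List ℚ → Set where
  done : [] ≼ []
  skip : ∀ {x ys xs} → 0ℚ ≤ x → ys ≼ xs → ys ≼ x ∷ xs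
  keep : ∀ {y x ys xs} → 0ℚ ≤ y → y ≤ x → ys ≼ xs → y ∷ ys ≼ x ∷ xs

≼⇒⊑ₚ : ∀ {ys xs} → ys ≼ xs → ys ⊑ₚ xs
≼⇒⊑ₚ done = ⊑ₚ-refl
≼⇒⊑ₚ (skip 0≤x ys≼xs) = ⊑ₚ-∷ʳ 0≤x (≼⇒⊑ₚ ys≼xs)
≼⇒⊑ₚ (keep _ y≤x ys≼xs) = ⊑ₚ-∷ y≤x (≼⇒⊑ₚ ys≼xs)

≼-nonNeg : ∀ {ys xs} → ys ≼ xs → All NonNeg ys
≼-nonNeg done = []
≼-nonNeg (skip _ ys≼xs) = ≼-nonNeg ys≼xs
≼-nonNeg (keep 0≤y _ ys≼xs) = 0≤y ∷ ≼-nonNeg ys≼xs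

[]≼ : ∀ {xs} → All NonNeg xs → [] ≼ xs
[]≼ [] = done
[]≼ (0≤x ∷ nn) = skip 0≤x ([]≼ nn)

≼-refl : ∀ {xs} → All NonNeg xs → xs ≼ xs
≼-refl [] = done
≼-refl (0≤x ∷ nn) = keep 0≤x ℚP.≤-refl (≼-refl nn)

≼-++ : ∀ {ys xs ys′ xs′} → ys ≼ xs → ys′ ≼ xs′ → ys ++ ys′ ≼ xs ++ xs′
≼-++ done q = q
≼-++ (skip 0≤x p) q = skip 0≤x (≼-++ p q)
≼-++ (keep 0≤y y≤x p) q = keep 0≤y y≤x (≼-++ p q)

replicate-≼ : ∀ t {x xs} → t ℕ.≤ length xs → 0ℚ ≤ x → All (x ≤_) xs → All NonNeg xs → replicate t x ≼ xs
replicate-≼ zero _ _ _ nn = []≼ nn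
replicate-≼ (suc t) (ℕ.s≤s t≤xs) 0≤x (x≤x′ ∷ x≤xs) (0≤x′ ∷ nn) = keep 0≤x x≤x′ (replicate-≼ t t≤xs 0≤x x≤xs nn)

roundClass-≼ : ∀ {B A} → length B ℕ.≤ length A → All NonNeg B → All (λ a → All (_≤ a) B) A → All NonNeg A →
               roundClass B ≼ A
roundClass-≼ {[]} _ _ _ nnA = []≼ nnA
roundClass-≼ {b ∷ B} B≤A (0≤b ∷ _) B≤as nnA = replicate-≼ (suc (length B)) B≤A 0≤b (All.map All.head B≤as) nnA

length-take-suc≤ : ∀ {A : Set} n (xs : List A) → length (take (suc n) xs) ℕ.≤ suc (length (take n xs))
length-take-suc≤ n       []       = ℕ.z≤n
length-take-suc≤ zero    (x ∷ xs) = ℕP.≤-refl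
length-take-suc≤ (suc n) (x ∷ xs) = ℕ.s≤s (length-take-suc≤ n xs)

length-take-drop≤ : ∀ {A : Set} {s′ s} (xs : List A) → s′ ℕ.≤ s → length (take s′ (drop s xs)) ℕ.≤ length (take s xs)
length-take-drop≤ {s′ = zero}           _        _            = ℕ.z≤n
length-take-drop≤ {s′ = suc s′} {suc s} []       _            = ℕ.z≤n
length-take-drop≤ {s′ = suc s′} {suc s} (x ∷ xs) (ℕ.s≤s s′≤s) =
  ℕP.≤-trans (length-take-suc≤ s′ (drop s xs)) (ℕ.s≤s (length-take-drop≤ xs s′≤s))

-- Each rounded class is dominated, item by item, by the class before it.
roundedClasses-≼ : ∀ ss L → Linked ℕ._≥_ ss → Desc L → All NonNeg L →
                   concat (map roundClass (drop 1 (splitBy ss L))) ≼ L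
roundedClasses-≼ []            L _ _ nn = []≼ nn
roundedClasses-≼ (s ∷ [])      L _ _ nn = []≼ nn
roundedClasses-≼ (s ∷ s′ ∷ ss) L (s′≤s ∷ sizes) desc nn =
  subst (roundClass (take s′ (drop s L)) ++ concat (map roundClass (drop 1 (splitBy (s′ ∷ ss) (drop s L)))) ≼_)
        (LP.take++drop≡id s L)
    (≼-++ (roundClass-≼ (length-take-drop≤ L s′≤s) (AllP.take⁺ s′ (AllP.drop⁺ s nn)) class≤previous (AllP.take⁺ s nn))
          (roundedClasses-≼ (s′ ∷ ss) (drop s L) sizes (AllPairsP.drop⁺ s desc) (AllP.drop⁺ s nn)))
  where
  class≤previous : All (λ a → All (_≤ a) (take s′ (drop s L))) (take s L)
  class≤previous = All.map (AllP.take⁺ s′) (AllPairs-++⁻ (take s L) (subst Desc (sym (LP.take++drop≡id s L)) desc))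

if-<ᵇ-antitone : ∀ i r → (if suc i ℕ.<ᵇ r then 1 else 0) ℕ.≤ (if i ℕ.<ᵇ r then 1 else 0)
if-<ᵇ-antitone i       zero          = ℕ.z≤n
if-<ᵇ-antitone zero    (suc zero)    = ℕ.z≤n
if-<ᵇ-antitone zero    (suc (suc r)) = ℕP.≤-refl
if-<ᵇ-antitone (suc i) (suc r)       = if-<ᵇ-antitone i r

classSizes-antitone : ∀ N c .{{_ : NonZero c}} → Linked ℕ._≥_ (classSizes N c)
classSizes-antitone N c = LinkedP.map⁺ (LinkedP.applyUpTo⁺₂ id c λ i → ℕP.+-monoʳ-≤ (N ℕ./ c) (if-<ᵇ-antitone i (N ℕ.% c)))

filter-++-filter-¬-↭ : ∀ {P : ℚ → Set} (P? : ∀ x → Dec (P x)) xs → filter P? xs ++ filter (¬? ∘ P?) xs ↭ xs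
filter-++-filter-¬-↭ P? [] = ↭-refl
filter-++-filter-¬-↭ P? (x ∷ xs) with does (P? x)
... | true  = ↭.prep x (filter-++-filter-¬-↭ P? xs)
... | false = ↭-trans (PermP.shift x (filter P? xs) _) (↭.prep x (filter-++-filter-¬-↭ P? xs))

rounded-≼ : ∀ m .{{_ : NonZero m}} {xs} → All NonNeg xs →
            rounded m xs ≼ smallItems m xs ++ sortDesc (largeItems m xs)
rounded-≼ m {xs} nn = ≼-++ (≼-refl (AllP.++⁻ˡ small nn′))
  (roundedClasses-≼ (classSizes (length large) (m ℕ.^ 3) {{ℕP.m^n≢0 m 3}}) (sortDesc large)
                    (classSizes-antitone (length large) (m ℕ.^ 3) {{ℕP.m^n≢0 m 3}}) (sortDesc-desc large)
                    (PermP.All-resp-↭ (↭-sym (sortDesc-↭ large)) (AllP.++⁻ʳ small nn′)))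
  where
  small = smallItems m xs
  large = largeItems m xs
  nn′ = PermP.All-resp-↭ (↭-sym (filter-++-filter-¬-↭ (λ x → x ℚP.<? eps m) xs)) nn

rounded-⊑ₚ : ∀ m .{{_ : NonZero m}} {xs} → All NonNeg xs → rounded m xs ⊑ₚ xs
rounded-⊑ₚ m {xs} nn = ⊑ₚ-trans (≼⇒⊑ₚ (rounded-≼ m nn))
  (↭⇒⊑ₚ (↭-trans (PermP.++⁺ˡ (smallItems m xs) (sortDesc-↭ (largeItems m xs))) (filter-++-filter-¬-↭ (λ x → x ℚP.<? eps m) xs)))

≤n+[n/m+1]⇒≤[1+eps]n+1 : ∀ m .{{_ : NonZero m}} {b n} → b ℕ.≤ n ℕ.+ (n ℕ./ m ℕ.+ 1) → nℚ b ≤ (1ℚ + eps m) * nℚ n + 1ℚ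
≤n+[n/m+1]⇒≤[1+eps]n+1 m {b} {n} b≤ = begin
  nℚ b                               ≤⟨ nℚ-mono-≤ b≤ ⟩
  nℚ (n ℕ.+ (n ℕ./ m ℕ.+ 1))         ≡⟨ trans (nℚ-+ n _) (cong (λ q → nℚ n + q) (nℚ-+ (n ℕ./ m) 1)) ⟩
  nℚ n + (nℚ (n ℕ./ m) + 1ℚ)         ≤⟨ ℚP.+-monoʳ-≤ (nℚ n) (ℚP.+-monoˡ-≤ 1ℚ (nℚ-≤-*1/ℕ {n ℕ./ m} {n} m (ℕD.m/n*n≤m n m))) ⟩
  nℚ n + (nℚ n * eps m + 1ℚ)         ≡⟨ solve 2 (λ n e → n :+ (n :* e :+ con 1ℚ) := (con 1ℚ :+ e) :* n :+ con 1ℚ) refl (nℚ n) (eps m) ⟩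
  (1ℚ + eps m) * nℚ n + 1ℚ           ∎
  where open ℚP.≤-Reasoning

lemma12 : (xs : List ℚ) → All (λ x → 0ℚ ≤ x × x ≤ 1ℚ) xs →
          (U : ℚ) (0<U : 0ℚ < U) → U ≤ 1ℚ →
          (k : ℕ) .{{_ : NonZero k}} → (m : ℕ) .{{_ : NonZero m}} →
          + (m ℕ.* m) ℤ.< floor (divByU k U 0<U) ℤ.+ + k →
          (opt : ℕ) → IsOptBPUP U k xs opt →
          Σ ℕ λ b → IsOptBPUP' U k m (rounded m xs) b × nℚ b ≤ (1ℚ + eps m) * nℚ opt + 1ℚ
lemma12 xs items U 0<U _ k m _ opt (opt-feasible , _) =
  let 0≤U = ℚP.<⇒≤ 0<U
      nonNeg = All.map proj₁ items
      (B , B↭I′ , |B|≡opt , B-feasible) =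
        FeasibleBPUP⇒bins 0≤U (rounded-⊑ₚ m nonNeg) (≼-nonNeg (rounded-≼ m nonNeg)) opt-feasible
      I′↭repackB = ↭-sym (↭-trans (concat-repack-↭ k m B) B↭I′)
      feasible′ = bins⇒FeasibleBPUP' 0≤U {m = m} (repack k m B) I′↭repackB (repack-feasible 0≤U B-feasible)
      (b , b-optimal) = optBPUP'-exists (rounded m xs) feasible′
      b≤ = subst (b ℕ.≤_) (trans (length-repack k m B) (cong (λ n → n ℕ.+ (n ℕ./ m ℕ.+ 1)) |B|≡opt))
                 (proj₂ b-optimal _ feasible′)
  in b , b-optimal , ≤n+[n/m+1]⇒≤[1+eps]n+1 m {b} {opt} b≤
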